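{- Let $X=(\omega+1)^\omega\cup(\omega+1)^{<\omega}$. For $\sigma\in(\omega+1)^{<\omega}$ and $n\le\omega$ let $C_{\sigma^\frown n}=\{\sigma\}\cup\{f\in(\omega+1)^\omega:\sigma^\frown n\subseteq f\}$, and let $\mathcal C=\{C_{\sigma^\frown n}:\sigma\in(\omega+1)^{<\omega},\ n\le\omega\}$. Then every point of $X$ lies in infinitely many members of $\mathcal C$, and there is no partition $\mathcal C=\mathcal C_0\cup\mathcal C_1$ into two disjoint subfamilies both of which cover $X$.
   Context: $\sigma^\frown n$ denotes the finite sequence obtained by appending $n$ to $\sigma$; $\sigma^\frown n\subseteq f$ means $f$ extends $\sigma^\frown n$. -}

module Defs where

open import Data.Nat using (ℕ; zero; suc)
open import Data.List using (List; []; _∷_; _++_; [_])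
open import Data.Product using (_×_)
open import Data.Unit using (⊤)
open import Relation.Binary.PropositionalEquality using (_≡_)

data Ω+1 : Set where
  fin : ℕ → Ω+1
  ω   : Ω+1

data X : Set where
  infSeq : (ℕ → Ω+1) → X
  finSeq : List Ω+1 → X

_⊑_ : List Ω+1 → (ℕ → Ω+1) → Set
[]      ⊑ f = ⊤
(a ∷ s) ⊑ f = (a ≡ f zero) × (s ⊑ (λ k → f (suc k)))

Index : Set
Index = List Ω+1 × Ω+1

_∈C_ : X → Index → Set
finSeq τ ∈C (σ Data.Product., n) = τ ≡ σ
infSeq f ∈C (σ Data.Product., n) = (σ ++ [ n ]) ⊑ f

-- Every finite σ lies in C_{σ⌢n} for all n, and every branch f lies in
-- C_{f↾k ⌢ f(k)} for all k. Given two covering subfamilies 𝒞₀ and 𝒞₁, let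
-- next(σ) be the n with σ covered by C_{σ⌢n} ∈ 𝒞₁, and follow next from the
-- empty sequence to obtain a branch f. The only sets containing f are the
-- C_{f↾k ⌢ f(k)} = C_{f↾k ⌢ next(f↾k)}, all of which lie in 𝒞₁; so the member of
-- 𝒞₀ covering f is also a member of 𝒞₁.
module Submission where

open import Defs
open import Data.Nat using (ℕ; zero; suc)
open import Data.Product using (_×_; Σ; ∃; _,_; proj₁; proj₂)
open import Data.Sum using (_⊎_)
open import Data.Unit using (tt)
open import Data.List using (List; []; _∷_; _∷ʳ_; length; applyUpTo)
open import Data.List.Properties using (length-applyUpTo; applyUpTo-∷ʳ)
open import Function using (_∘_)
open import Function.Definitions using (Injective)
open import Relation.Nullary using (¬_)
open import Relation.Binary.PropositionalEquality
  using (_≡_; refl; sym; trans; cong; cong₂; subst; module ≡-Reasoning)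

applyUpTo-⊑ : ∀ f k → applyUpTo f k ⊑ f
applyUpTo-⊑ f zero    = tt
applyUpTo-⊑ f (suc k) = refl , applyUpTo-⊑ (f ∘ suc) k

∷ʳ-⊑⇒ : ∀ σ {n f} → (σ ∷ʳ n) ⊑ f → σ ≡ applyUpTo f (length σ) × n ≡ f (length σ)
∷ʳ-⊑⇒ []      (n≡f0 , _)       = refl , n≡f0
∷ʳ-⊑⇒ (a ∷ σ) (a≡f0 , σ∷ʳn⊑f′) with ∷ʳ-⊑⇒ σ σ∷ʳn⊑f′
... | σ≡ , n≡ = cong₂ _∷_ a≡f0 σ≡ , n≡

infSeq-∈C : ∀ f k → infSeq f ∈C (applyUpTo f k , f k)
infSeq-∈C f k = subst (_⊑ f) (sym (applyUpTo-∷ʳ f k)) (applyUpTo-⊑ f (suc k))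

in-infinitely-many : (x : X) → Σ (ℕ → Index) (λ g → Injective _≡_ _≡_ g × ((k : ℕ) → x ∈C g k))
in-infinitely-many (finSeq τ) = (λ k → τ , fin k) , (λ where refl → refl) , λ _ → refl
in-infinitely-many (infSeq f) = (λ k → applyUpTo f k , f k) , injective , infSeq-∈C f
  where
  injective : Injective _≡_ _≡_ (λ k → applyUpTo f k , f k)
  injective {j} {k} e = begin
    j                           ≡⟨ sym (length-applyUpTo f j) ⟩
    length (applyUpTo f j)      ≡⟨ cong (length ∘ proj₁) e ⟩
    length (applyUpTo f k)      ≡⟨ length-applyUpTo f k ⟩
    k                           ∎
    where open ≡-Reasoning

module _ (next : List Ω+1 → Ω+1) where

  stem : ℕ → List Ω+1
  stem zero    = []
  stem (suc k) = stem k ∷ʳ next (stem k)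

  branch : ℕ → Ω+1
  branch k = next (stem k)

  applyUpTo-branch : ∀ k → applyUpTo branch k ≡ stem k
  applyUpTo-branch zero    = refl
  applyUpTo-branch (suc k) = begin
    applyUpTo branch (suc k)       ≡⟨ sym (applyUpTo-∷ʳ branch k) ⟩
    applyUpTo branch k ∷ʳ branch k ≡⟨ cong (_∷ʳ branch k) (applyUpTo-branch k) ⟩
    stem k ∷ʳ next (stem k)        ∎
    where open ≡-Reasoning

  branch-∈C⇒next : ∀ σ n → infSeq branch ∈C (σ , n) → n ≡ next σ
  branch-∈C⇒next σ n σ∷ʳn⊑branch with ∷ʳ-⊑⇒ σ σ∷ʳn⊑branch
  ... | σ≡ , n≡ = trans n≡ (cong next (sym (trans σ≡ (applyUpTo-branch (length σ)))))

Covers : (Index → Set) → Set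
Covers P = (x : X) → ∃ (λ i → P i × x ∈C i)

covers-share-member : ∀ {P₀ P₁ : Index → Set} → Covers P₀ → Covers P₁ → ∃ (λ i → P₀ i × P₁ i)
covers-share-member {P₁ = P₁} cov₀ cov₁ =
  let (σ , n) , p₀ , σn∋branch = cov₀ (infSeq (branch next))
  in (σ , n) , p₀ , subst (λ m → P₁ (σ , m)) (sym (branch-∈C⇒next next σ n σn∋branch)) (P₁-next σ)
  where
  next : List Ω+1 → Ω+1
  next σ = proj₂ (proj₁ (cov₁ (finSeq σ)))

  P₁-next : ∀ σ → P₁ (σ , next σ)
  P₁-next σ with cov₁ (finSeq σ)
  ... | _ , p₁ , refl = p₁

lemma7p3 : ((x : X) → Σ (ℕ → Index) (λ g → Injective _≡_ _≡_ g × ((k : ℕ) → x ∈C g k)))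
    × ¬ (Σ (Index → Set) (λ P₀ → Σ (Index → Set) (λ P₁ →
    ((i : Index) → P₀ i ⊎ P₁ i)
    × ((i : Index) → ¬ (P₀ i × P₁ i))
    × ((x : X) → ∃ (λ i → P₀ i × x ∈C i))
    × ((x : X) → ∃ (λ i → P₁ i × x ∈C i)))))
lemma7p3 = in-infinitely-many , λ (_ , _ , _ , disjoint , cov₀ , cov₁) →
  let i , p₀ , p₁ = covers-share-member cov₀ cov₁ in disjoint i (p₀ , p₁)
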